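{- For every integer $n\ge 2$, $\binom{1,n}{n-2,2}$ equals the total number of possible bishop moves on an $n\times n$ chessboard (ordered pairs of distinct squares lying on a common diagonal line, i.e. squares $(a,b),(c,d)$ with $|a-c|=|b-d|\ge1$), and this number is $\frac{2n(2n-1)(n-1)}{3}$.
   Context: For a nonnegative integer $m$ and positive integers $n,q$, let $X$ be a set which is the disjoint union of $n$ "main blocks" each of size $q$ and an "additional block" of size $m$. An $(n+k)$-inset of $X$ is an $(n+k)$-element subset of $X$ that intersects every main block; their number is denoted $\binom{m,n}{k,q}$. -}

module Defs where

open import Data.Nat using (ℕ; zero; suc; _+_; _≟_; _≤?_; _≤_; ∣_-_∣)
open import Data.Fin using (Fin; toℕ)
open import Data.Fin.Subset using (Subset; inside; outside; ∣_∣; Nonempty)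
open import Data.Fin.Subset.Properties using (nonempty?)
open import Data.Vec using (Vec; []; _∷_)
import Data.Vec as Vec
open import Data.Vec.Relation.Unary.All using (All; all?)
open import Data.List using (List; []; _∷_; [_]; concatMap; map; filter; length; allFin; cartesianProduct)
open import Data.Product using (_×_; _,_; proj₁; proj₂)
open import Relation.Nullary.Decidable using (_×-dec_; Dec)
open import Relation.Binary.PropositionalEquality using (_≡_)

allSubsets : (k : ℕ) → List (Subset k)
allSubsets zero = [ [] ]
allSubsets (suc k) = concatMap (λ s → (inside ∷ s) ∷ (outside ∷ s) ∷ []) (allSubsets k)

allTuples : (n q : ℕ) → List (Vec (Subset q) n)
allTuples zero q = [ [] ]
allTuples (suc n) q =
  concatMap (λ S → map (S ∷_) (allTuples n q)) (allSubsets q)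

-- X = (Fin n × Fin q) ⊎ Fin m : n main blocks of size q, additional block of size m.
-- A subset of X is given by its trace on each main block and on the additional block.
SubsetX : (m n q : ℕ) → Set
SubsetX m n q = Vec (Subset q) n × Subset m

allSubsetsX : (m n q : ℕ) → List (SubsetX m n q)
allSubsetsX m n q = cartesianProduct (allTuples n q) (allSubsets m)

cardX : ∀ {m n q} → SubsetX m n q → ℕ
cardX (Ss , T) = Vec.sum (Vec.map ∣_∣ Ss) + ∣ T ∣

IsInset : (m n k q : ℕ) → SubsetX m n q → Set
IsInset m n k q A = (cardX A ≡ n + k) × All Nonempty (proj₁ A)

isInset? : ∀ m n k q (A : SubsetX m n q) → Dec (IsInset m n k q A)
isInset? m n k q A = (cardX A ≟ n + k) ×-dec all? nonempty? (proj₁ A)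

-- the number  binom{m,n}{k,q}  of (n+k)-insets
inset : (m n k q : ℕ) → ℕ
inset m n k q = length (filter (isInset? m n k q) (allSubsetsX m n q))

Square : ℕ → Set
Square n = Fin n × Fin n

allSquares : (n : ℕ) → List (Square n)
allSquares n = cartesianProduct (allFin n) (allFin n)

IsBishopMove : ∀ {n} → Square n × Square n → Set
IsBishopMove ((a , b) , (c , d)) =
  (∣ toℕ a - toℕ c ∣ ≡ ∣ toℕ b - toℕ d ∣) × (1 ≤ ∣ toℕ a - toℕ c ∣)

isBishopMove? : ∀ {n} (x : Square n × Square n) → Dec (IsBishopMove x)
isBishopMove? ((a , b) , (c , d)) =
  (∣ toℕ a - toℕ c ∣ ≟ ∣ toℕ b - toℕ d ∣) ×-dec (1 ≤? ∣ toℕ a - toℕ c ∣)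

bishopMoves : ℕ → ℕ
bishopMoves n =
  length (filter isBishopMove? (cartesianProduct (allSquares n) (allSquares n)))

-- Both numbers equal 4 (0² + 1² + ⋯ + (n-1)²).
--
-- Insets: |X| = 2n + 1, so a (2n-2)-inset is the complement of three points, no two of
-- which form a main block. Grouping subsets by their traces on the main blocks, the
-- n-tuples of nonempty subsets of a 2-set missing d points in total number 2ᵈ·C(n,d);
-- the extra point is missed or not, so the count is 8·C(n,3) + 4·C(n,2), and
-- 2·C(n,3) + C(n,2) = Σ_{i<n} i² by Pascal's rule.
--
-- Bishop moves: between two rows at distance k ≥ 1 there are 2(n-k) moves, and there are
-- 2(n-k) ordered pairs of such rows, giving Σₖ 4(n-k)².
module Submission where

open import Defs
open import Data.Nat using (ℕ; _≤_; _*_; _∸_; _/_)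
open import Data.Product using (_×_)
open import Relation.Binary.PropositionalEquality using (_≡_)

open import Data.Bool using (false; true; if_then_else_)
open import Data.Fin using (toℕ)
open import Data.Fin.Subset using (Subset; ∣_∣)
open import Data.Fin.Subset.Properties using (nonempty?)
open import Data.List using (List; []; _∷_; map; filter; length; allFin; tabulate; concatMap; cartesianProduct; _++_)
open import Data.List.Properties using (map-++; map-∘; map-cong; map-tabulate)
open import Data.Nat using (zero; suc; _+_; _^_; _≟_; _≤?_; _<_; ∣_-_∣; s≤s)
open import Data.Nat.Combinatorics using (_C_; nC1≡n; nCk+nC[k+1]≡[n+1]C[k+1])
open import Data.Nat.DivMod using (m*n/n≡m)
open import Data.Nat.ListAction using (sum)
open import Data.Nat.ListAction.Properties using (sum-++)
open import Data.Nat.Properties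
open import Algebra.Properties.CommutativeSemigroup +-commutativeSemigroup using (interchange)
open import Data.Nat.Tactic.RingSolver using (solve-∀)
open import Data.Product using (_,_; proj₁; proj₂)
open import Data.Vec using (Vec)
import Data.Vec as Vec
open import Data.Vec.Relation.Unary.All using (all?)
open import Relation.Nullary using (Dec; does)
open import Relation.Nullary.Decidable using (_×-dec_)
open import Relation.Binary.PropositionalEquality using (refl; sym; trans; cong; cong₂; module ≡-Reasoning)

open ≡-Reasoning

indicator : ∀ {p} {P : Set p} → Dec P → ℕ
indicator P? = if does P? then 1 else 0

indicator-×-dec : ∀ {p q} {P : Set p} {Q : Set q} (P? : Dec P) (Q? : Dec Q) →
  indicator (P? ×-dec Q?) ≡ indicator Q? * indicator P?
indicator-×-dec P? Q? with does P? | does Q?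
... | false | false = refl
... | false | true  = refl
... | true  | false = refl
... | true  | true  = refl

module _ {a} {A : Set a} where

  length-filter≡sum-indicator : ∀ {p} {P : A → Set p} (P? : ∀ x → Dec (P x)) xs →
    length (filter P? xs) ≡ sum (map (λ x → indicator (P? x)) xs)
  length-filter≡sum-indicator P? [] = refl
  length-filter≡sum-indicator P? (x ∷ xs) with does (P? x)
  ... | false = length-filter≡sum-indicator P? xs
  ... | true  = cong suc (length-filter≡sum-indicator P? xs)

  sum-map-cong : ∀ {f g : A → ℕ} → (∀ x → f x ≡ g x) → ∀ xs → sum (map f xs) ≡ sum (map g xs)
  sum-map-cong f≗g xs = cong sum (map-cong f≗g xs)

  sum-map-zero : ∀ {f : A → ℕ} → (∀ x → f x ≡ 0) → ∀ xs → sum (map f xs) ≡ 0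
  sum-map-zero f≗0 [] = refl
  sum-map-zero f≗0 (x ∷ xs) = cong₂ _+_ (f≗0 x) (sum-map-zero f≗0 xs)

  sum-map-+ : ∀ (f g : A → ℕ) xs → sum (map (λ x → f x + g x) xs) ≡ sum (map f xs) + sum (map g xs)
  sum-map-+ f g [] = refl
  sum-map-+ f g (x ∷ xs) = begin
    f x + g x + sum (map (λ x → f x + g x) xs)    ≡⟨ cong (f x + g x +_) (sum-map-+ f g xs) ⟩
    f x + g x + (sum (map f xs) + sum (map g xs)) ≡⟨ interchange (f x) (g x) _ _ ⟩
    f x + sum (map f xs) + (g x + sum (map g xs)) ∎

  sum-map-concatMap : ∀ {b} {B : Set b} (g : B → ℕ) (f : A → List B) xs →
    sum (map g (concatMap f xs)) ≡ sum (map (λ x → sum (map g (f x))) xs)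
  sum-map-concatMap g f [] = refl
  sum-map-concatMap g f (x ∷ xs) = begin
    sum (map g (f x ++ concatMap f xs))            ≡⟨ cong sum (map-++ g (f x) _) ⟩
    sum (map g (f x) ++ map g (concatMap f xs))    ≡⟨ sum-++ (map g (f x)) _ ⟩
    sum (map g (f x)) + sum (map g (concatMap f xs))         ≡⟨ cong (sum (map g (f x)) +_) (sum-map-concatMap g f xs) ⟩
    sum (map g (f x)) + sum (map (λ x → sum (map g (f x))) xs) ∎

  sum-map-cartesianProduct : ∀ {b} {B : Set b} (g : A × B → ℕ) xs (ys : List B) →
    sum (map g (cartesianProduct xs ys)) ≡ sum (map (λ x → sum (map (λ y → g (x , y)) ys)) xs)
  sum-map-cartesianProduct g [] ys = refl
  sum-map-cartesianProduct g (x ∷ xs) ys = begin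
    sum (map g (map (x ,_) ys ++ cartesianProduct xs ys))
      ≡⟨ cong sum (map-++ g (map (x ,_) ys) _) ⟩
    sum (map g (map (x ,_) ys) ++ map g (cartesianProduct xs ys))
      ≡⟨ sum-++ (map g (map (x ,_) ys)) _ ⟩
    sum (map g (map (x ,_) ys)) + sum (map g (cartesianProduct xs ys))
      ≡⟨ cong₂ _+_ (cong sum (sym (map-∘ ys))) (sum-map-cartesianProduct g xs ys) ⟩
    sum (map (λ y → g (x , y)) ys) + sum (map (λ x → sum (map (λ y → g (x , y)) ys)) xs) ∎

∑ : ℕ → (ℕ → ℕ) → ℕ
∑ zero    f = 0
∑ (suc n) f = f 0 + ∑ n (λ i → f (suc i))

∑-cong : ∀ n {f g : ℕ → ℕ} → (∀ i → f i ≡ g i) → ∑ n f ≡ ∑ n g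
∑-cong zero    f≗g = refl
∑-cong (suc n) f≗g = cong₂ _+_ (f≗g 0) (∑-cong n (λ i → f≗g (suc i)))

∑-zero : ∀ n → ∑ n (λ _ → 0) ≡ 0
∑-zero zero    = refl
∑-zero (suc n) = ∑-zero n

∑-distrib-+ : ∀ n (f g : ℕ → ℕ) → ∑ n (λ i → f i + g i) ≡ ∑ n f + ∑ n g
∑-distrib-+ zero    f g = refl
∑-distrib-+ (suc n) f g = begin
  f 0 + g 0 + ∑ n (λ i → f (suc i) + g (suc i))
    ≡⟨ cong (f 0 + g 0 +_) (∑-distrib-+ n (λ i → f (suc i)) (λ i → g (suc i))) ⟩
  f 0 + g 0 + (∑ n (λ i → f (suc i)) + ∑ n (λ i → g (suc i)))
    ≡⟨ interchange (f 0) (g 0) _ _ ⟩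
  f 0 + ∑ n (λ i → f (suc i)) + (g 0 + ∑ n (λ i → g (suc i))) ∎

*-distribˡ-∑ : ∀ n c (f : ℕ → ℕ) → ∑ n (λ i → c * f i) ≡ c * ∑ n f
*-distribˡ-∑ zero    c f = sym (*-zeroʳ c)
*-distribˡ-∑ (suc n) c f = begin
  c * f 0 + ∑ n (λ i → c * f (suc i)) ≡⟨ cong (c * f 0 +_) (*-distribˡ-∑ n c (λ i → f (suc i))) ⟩
  c * f 0 + c * ∑ n (λ i → f (suc i)) ≡⟨ *-distribˡ-+ c (f 0) _ ⟨
  c * (f 0 + ∑ n (λ i → f (suc i)))   ∎

∑-comm : ∀ m n (f : ℕ → ℕ → ℕ) → ∑ m (λ i → ∑ n (λ j → f i j)) ≡ ∑ n (λ j → ∑ m (λ i → f i j))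
∑-comm zero    n f = sym (∑-zero n)
∑-comm (suc m) n f = begin
  ∑ n (f 0) + ∑ m (λ i → ∑ n (f (suc i))) ≡⟨ cong (∑ n (f 0) +_) (∑-comm m n (λ i → f (suc i))) ⟩
  ∑ n (f 0) + ∑ n (λ j → ∑ m (λ i → f (suc i) j)) ≡⟨ ∑-distrib-+ n (f 0) _ ⟨
  ∑ n (λ j → f 0 j + ∑ m (λ i → f (suc i) j)) ∎

∑-init-last : ∀ n f → ∑ (suc n) f ≡ ∑ n f + f n
∑-init-last zero    f = +-comm (f 0) 0
∑-init-last (suc n) f = begin
  f 0 + ∑ (suc n) (λ i → f (suc i)) ≡⟨ cong (f 0 +_) (∑-init-last n (λ i → f (suc i))) ⟩
  f 0 + (∑ n (λ i → f (suc i)) + f (suc n)) ≡⟨ +-assoc (f 0) _ _ ⟨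
  f 0 + ∑ n (λ i → f (suc i)) + f (suc n) ∎

sum-allFin : ∀ n (f : ℕ → ℕ) → sum (map (λ i → f (toℕ i)) (allFin n)) ≡ ∑ n f
sum-allFin n f = trans (cong sum (map-tabulate {n = n} (λ i → i) (λ i → f (toℕ i)))) (sum-tabulate n f)
  where
  sum-tabulate : ∀ n (f : ℕ → ℕ) → sum (tabulate {n = n} (λ i → f (toℕ i))) ≡ ∑ n f
  sum-tabulate zero    f = refl
  sum-tabulate (suc n) f = cong (f 0 +_) (sum-tabulate n (λ i → f (suc i)))

sum-allSquares : ∀ n (f : ℕ → ℕ → ℕ) →
  sum (map (λ p → f (toℕ (proj₁ p)) (toℕ (proj₂ p))) (allSquares n)) ≡ ∑ n (λ a → ∑ n (f a))
sum-allSquares n f = begin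
  sum (map (λ p → f (toℕ (proj₁ p)) (toℕ (proj₂ p))) (allSquares n))
    ≡⟨ sum-map-cartesianProduct _ (allFin n) (allFin n) ⟩
  sum (map (λ a → sum (map (λ b → f (toℕ a) (toℕ b)) (allFin n))) (allFin n))
    ≡⟨ sum-map-cong (λ a → sum-allFin n (f (toℕ a))) (allFin n) ⟩
  sum (map (λ a → ∑ n (f (toℕ a))) (allFin n))
    ≡⟨ sum-allFin n (λ a → ∑ n (f a)) ⟩
  ∑ n (λ a → ∑ n (f a)) ∎

distanceSum : ℕ → (ℕ → ℕ) → ℕ
distanceSum n F = ∑ n (λ x → ∑ n (λ y → F ∣ x - y ∣))

distanceSum-suc : ∀ n F → distanceSum (suc n) F ≡ F 0 + 2 * ∑ n (λ d → F (suc d)) + distanceSum n F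
distanceSum-suc n F = begin
  F 0 + A + ∑ n (λ x → F (suc x) + ∑ n (λ y → F ∣ x - y ∣))
    ≡⟨ cong (F 0 + A +_) (∑-distrib-+ n (λ x → F (suc x)) (λ x → ∑ n (λ y → F ∣ x - y ∣))) ⟩
  F 0 + A + (A + distanceSum n F)
    ≡⟨ regroup (F 0) A (distanceSum n F) ⟩
  F 0 + 2 * A + distanceSum n F ∎
  where
  A = ∑ n (λ d → F (suc d))
  regroup : ∀ x a s → x + a + (a + s) ≡ x + 2 * a + s
  regroup = solve-∀

∑-indicator-≟ : ∀ n k → ∑ n (λ d → indicator (k ≟ d)) + (n ∸ suc k) ≡ n ∸ k
∑-indicator-≟ zero    k       = sym (0∸n≡0 k)
∑-indicator-≟ (suc n) zero    = cong (λ s → suc (s + n)) (∑-zero n)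
∑-indicator-≟ (suc n) (suc k) = ∑-indicator-≟ n k

distanceSum-atDistance : ∀ n k → distanceSum n (λ j → indicator (suc k ≟ j)) ≡ 2 * (n ∸ suc k)
distanceSum-atDistance zero    k = refl
distanceSum-atDistance (suc n) k = begin
  distanceSum (suc n) (λ j → indicator (suc k ≟ j))
    ≡⟨ distanceSum-suc n (λ j → indicator (suc k ≟ j)) ⟩
  2 * A + distanceSum n (λ j → indicator (suc k ≟ j))
    ≡⟨ cong (2 * A +_) (distanceSum-atDistance n k) ⟩
  2 * A + 2 * (n ∸ suc k)
    ≡⟨ *-distribˡ-+ 2 A (n ∸ suc k) ⟨
  2 * (A + (n ∸ suc k))
    ≡⟨ cong (2 *_) (∑-indicator-≟ n k) ⟩
  2 * (n ∸ k) ∎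
  where A = ∑ n (λ d → indicator (k ≟ d))

movesBetweenRows : ℕ → ℕ → ℕ
movesBetweenRows n zero    = 0
movesBetweenRows n (suc k) = 2 * (n ∸ suc k)

∑∑-diagonalIndicator : ∀ n k →
  ∑ n (λ b → ∑ n (λ d → indicator ((k ≟ ∣ b - d ∣) ×-dec (1 ≤? k)))) ≡ movesBetweenRows n k
∑∑-diagonalIndicator n k = begin
  ∑ n (λ b → ∑ n (λ d → indicator ((k ≟ ∣ b - d ∣) ×-dec (1 ≤? k))))
    ≡⟨ ∑-cong n (λ b → ∑-cong n (λ d → indicator-×-dec (k ≟ ∣ b - d ∣) (1 ≤? k))) ⟩
  ∑ n (λ b → ∑ n (λ d → indicator (1 ≤? k) * indicator (k ≟ ∣ b - d ∣)))
    ≡⟨ ∑-cong n (λ b → *-distribˡ-∑ n (indicator (1 ≤? k)) _) ⟩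
  ∑ n (λ b → indicator (1 ≤? k) * ∑ n (λ d → indicator (k ≟ ∣ b - d ∣)))
    ≡⟨ *-distribˡ-∑ n (indicator (1 ≤? k)) _ ⟩
  indicator (1 ≤? k) * distanceSum n (λ j → indicator (k ≟ j))
    ≡⟨ nonzeroDistance k ⟩
  movesBetweenRows n k ∎
  where
  nonzeroDistance : ∀ k → indicator (1 ≤? k) * distanceSum n (λ j → indicator (k ≟ j)) ≡ movesBetweenRows n k
  nonzeroDistance zero    = refl
  nonzeroDistance (suc k) = trans (+-identityʳ _) (distanceSum-atDistance n k)

∑[M∸i]+∑[i]≡n*M : ∀ M n → n ≤ M → ∑ n (λ i → M ∸ i) + ∑ n (λ i → i) ≡ n * M
∑[M∸i]+∑[i]≡n*M M zero    _   = refl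
∑[M∸i]+∑[i]≡n*M M (suc n) n<M = begin
  ∑ (suc n) (λ i → M ∸ i) + ∑ (suc n) (λ i → i)
    ≡⟨ cong₂ _+_ (∑-init-last n (λ i → M ∸ i)) (∑-init-last n (λ i → i)) ⟩
  ∑ n (λ i → M ∸ i) + (M ∸ n) + (∑ n (λ i → i) + n)
    ≡⟨ interchange (∑ n (λ i → M ∸ i)) (M ∸ n) _ n ⟩
  ∑ n (λ i → M ∸ i) + ∑ n (λ i → i) + ((M ∸ n) + n)
    ≡⟨ cong₂ _+_ (∑[M∸i]+∑[i]≡n*M M n n≤M) (m∸n+n≡m n≤M) ⟩
  n * M + M
    ≡⟨ +-comm (n * M) M ⟩
  suc n * M ∎
  where n≤M = ≤-trans (n≤1+n n) n<M

distanceSum-movesBetweenRows : ∀ n D →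
  distanceSum n (movesBetweenRows (n + D)) ≡ 4 * D * ∑ n (λ i → i) + 4 * ∑ n (λ i → i * i)
distanceSum-movesBetweenRows zero    D = sym (trans (+-identityʳ (4 * D * 0)) (*-zeroʳ (4 * D)))
distanceSum-movesBetweenRows (suc n) D = begin
  distanceSum (suc n) (movesBetweenRows (suc n + D))
    ≡⟨ distanceSum-suc n (movesBetweenRows (suc n + D)) ⟩
  2 * ∑ n (λ i → 2 * (n + D ∸ i)) + distanceSum n (movesBetweenRows (suc n + D))
    ≡⟨ cong₂ (λ x y → 2 * x + distanceSum n (movesBetweenRows y))
             (*-distribˡ-∑ n 2 (λ i → n + D ∸ i)) (sym (+-suc n D)) ⟩
  2 * (2 * T) + distanceSum n (movesBetweenRows (n + suc D))
    ≡⟨ cong (2 * (2 * T) +_) (distanceSum-movesBetweenRows n (suc D)) ⟩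
  2 * (2 * T) + (4 * suc D * P + 4 * Q)
    ≡⟨ regroup T D P Q ⟩
  4 * (T + P) + 4 * D * P + 4 * Q
    ≡⟨ cong (λ x → 4 * x + 4 * D * P + 4 * Q) (∑[M∸i]+∑[i]≡n*M (n + D) n (m≤m+n n D)) ⟩
  4 * (n * (n + D)) + 4 * D * P + 4 * Q
    ≡⟨ expand n D P Q ⟩
  4 * D * (P + n) + 4 * (Q + n * n)
    ≡⟨ cong₂ (λ x y → 4 * D * x + 4 * y) (∑-init-last n (λ i → i)) (∑-init-last n (λ i → i * i)) ⟨
  4 * D * ∑ (suc n) (λ i → i) + 4 * ∑ (suc n) (λ i → i * i) ∎
  where
  T = ∑ n (λ i → n + D ∸ i)
  P = ∑ n (λ i → i)
  Q = ∑ n (λ i → i * i)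
  regroup : ∀ t d p q → 2 * (2 * t) + (4 * suc d * p + 4 * q) ≡ 4 * (t + p) + 4 * d * p + 4 * q
  regroup = solve-∀
  expand : ∀ n d p q → 4 * (n * (n + d)) + 4 * d * p + 4 * q ≡ 4 * d * (p + n) + 4 * (q + n * n)
  expand = solve-∀

bishopIndicator : ℕ → ℕ → ℕ → ℕ → ℕ
bishopIndicator a b c d = indicator ((∣ a - c ∣ ≟ ∣ b - d ∣) ×-dec (1 ≤? ∣ a - c ∣))

bishopMoves≡∑ : ∀ n →
  bishopMoves n ≡ ∑ n (λ a → ∑ n (λ b → ∑ n (λ c → ∑ n (λ d → bishopIndicator a b c d))))
bishopMoves≡∑ n = begin
  bishopMoves n
    ≡⟨ length-filter≡sum-indicator isBishopMove? (cartesianProduct (allSquares n) (allSquares n)) ⟩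
  sum (map (λ m → indicator (isBishopMove? m)) (cartesianProduct (allSquares n) (allSquares n)))
    ≡⟨ sum-map-cartesianProduct _ (allSquares n) (allSquares n) ⟩
  sum (map (λ p → sum (map (λ q → indicator (isBishopMove? (p , q))) (allSquares n))) (allSquares n))
    ≡⟨ sum-map-cong (λ p → sum-allSquares n (bishopIndicator (toℕ (proj₁ p)) (toℕ (proj₂ p)))) (allSquares n) ⟩
  sum (map (λ p → ∑ n (λ c → ∑ n (bishopIndicator (toℕ (proj₁ p)) (toℕ (proj₂ p)) c))) (allSquares n))
    ≡⟨ sum-allSquares n (λ a b → ∑ n (λ c → ∑ n (bishopIndicator a b c))) ⟩
  ∑ n (λ a → ∑ n (λ b → ∑ n (λ c → ∑ n (bishopIndicator a b c)))) ∎

bishopMoves≡4*∑[i*i] : ∀ n → bishopMoves n ≡ 4 * ∑ n (λ i → i * i)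
bishopMoves≡4*∑[i*i] n = begin
  bishopMoves n
    ≡⟨ bishopMoves≡∑ n ⟩
  ∑ n (λ a → ∑ n (λ b → ∑ n (λ c → ∑ n (bishopIndicator a b c))))
    ≡⟨ ∑-cong n (λ a → ∑-comm n n (λ b c → ∑ n (bishopIndicator a b c))) ⟩
  ∑ n (λ a → ∑ n (λ c → ∑ n (λ b → ∑ n (λ d → bishopIndicator a b c d))))
    ≡⟨ ∑-cong n (λ a → ∑-cong n (λ c → ∑∑-diagonalIndicator n ∣ a - c ∣)) ⟩
  distanceSum n (movesBetweenRows n)
    ≡⟨ cong (λ m → distanceSum n (movesBetweenRows m)) (+-identityʳ n) ⟨
  distanceSum n (movesBetweenRows (n + 0))
    ≡⟨ distanceSum-movesBetweenRows n 0 ⟩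
  4 * 0 * ∑ n (λ i → i) + 4 * ∑ n (λ i → i * i)
    ≡⟨⟩
  4 * ∑ n (λ i → i * i) ∎

size : ∀ {n} → Vec (Subset 2) n → ℕ
size Ss = Vec.sum (Vec.map ∣_∣ Ss)

allNonempty : ∀ {n} → Vec (Subset 2) n → ℕ
allNonempty Ss = indicator (all? nonempty? Ss)

nonemptyTupleSum : ℕ → (ℕ → ℕ) → ℕ
nonemptyTupleSum n F = sum (map (λ Ss → allNonempty Ss * F (size Ss)) (allTuples n 2))

nonemptyTupleSum-cong : ∀ n {F G : ℕ → ℕ} → (∀ s → F s ≡ G s) → nonemptyTupleSum n F ≡ nonemptyTupleSum n G
nonemptyTupleSum-cong n F≗G = sum-map-cong (λ Ss → cong (allNonempty Ss *_) (F≗G (size Ss))) (allTuples n 2)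

-- The first block is full (one way) or a singleton (two ways).
nonemptyTupleSum-suc : ∀ n F →
  nonemptyTupleSum (suc n) F ≡ nonemptyTupleSum n (λ s → F (2 + s)) + 2 * nonemptyTupleSum n (λ s → F (1 + s))
nonemptyTupleSum-suc n F = begin
  sum (map g (concatMap (λ S → map (S Vec.∷_) (allTuples n 2)) (allSubsets 2)))
    ≡⟨ sum-map-concatMap g (λ S → map (S Vec.∷_) (allTuples n 2)) (allSubsets 2) ⟩
  sum (map (λ S → sum (map g (map (S Vec.∷_) (allTuples n 2)))) (allSubsets 2))
    ≡⟨ sum-map-cong (λ S → cong sum (sym (map-∘ {g = g} {f = S Vec.∷_} (allTuples n 2)))) (allSubsets 2) ⟩
  sum (map (λ S → sum (map (λ Ss → g (S Vec.∷ Ss)) (allTuples n 2))) (allSubsets 2))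
    ≡⟨ cong (λ z → A + (B + (B + (z + 0)))) (sum-map-zero (λ _ → refl) (allTuples n 2)) ⟩
  A + 2 * B ∎
  where
  g : Vec (Subset 2) (suc n) → ℕ
  g Ss = allNonempty Ss * F (size Ss)
  A = nonemptyTupleSum n (λ s → F (2 + s))
  B = nonemptyTupleSum n (λ s → F (1 + s))

nonemptyTupleSum-beyond : ∀ n t → n + n < t → nonemptyTupleSum n (λ s → indicator (s ≟ t)) ≡ 0
nonemptyTupleSum-beyond zero    (suc t)       _                   = refl
nonemptyTupleSum-beyond (suc n) (suc (suc t)) (s≤s (s≤s n+1+n≤t)) = begin
  nonemptyTupleSum (suc n) (λ s → indicator (s ≟ suc (suc t)))
    ≡⟨ nonemptyTupleSum-suc n (λ s → indicator (s ≟ suc (suc t))) ⟩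
  nonemptyTupleSum n (λ s → indicator (s ≟ t)) + 2 * nonemptyTupleSum n (λ s → indicator (s ≟ suc t))
    ≡⟨ cong₂ (λ x y → x + 2 * y) (nonemptyTupleSum-beyond n t 2n<t)
                                 (nonemptyTupleSum-beyond n (suc t) (m<n⇒m<1+n 2n<t)) ⟩
  0 ∎
  where
  2n<t : n + n < t
  2n<t = ≤-trans (≤-reflexive (sym (+-suc n n))) n+1+n≤t

-- Tuples missing d of the 2n points: 2ᵈ choices of a point in each of d chosen blocks.
nonemptyTupleSum-deficit : ∀ n d → nonemptyTupleSum n (λ s → indicator (s + d ≟ n + n)) ≡ 2 ^ d * (n C d)
nonemptyTupleSum-deficit zero    zero    = refl
nonemptyTupleSum-deficit zero    (suc d) = sym (*-zeroʳ (2 ^ suc d))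
nonemptyTupleSum-deficit (suc n) zero    = begin
  nonemptyTupleSum (suc n) (λ s → indicator (s + 0 ≟ suc n + suc n))
    ≡⟨ nonemptyTupleSum-suc n (λ s → indicator (s + 0 ≟ suc n + suc n)) ⟩
  nonemptyTupleSum n (λ s → indicator (suc (suc s) + 0 ≟ suc n + suc n))
    + 2 * nonemptyTupleSum n (λ s → indicator (suc s + 0 ≟ suc n + suc n))
    ≡⟨ cong₂ (λ x y → x + 2 * y)
             (nonemptyTupleSum-cong n (λ s → cong (λ m → indicator (suc s + 0 ≟ m)) (+-suc n n)))
             (nonemptyTupleSum-cong n (λ s → cong₂ (λ x m → indicator (x ≟ m)) (+-identityʳ s) refl)) ⟩
  nonemptyTupleSum n (λ s → indicator (s + 0 ≟ n + n))
    + 2 * nonemptyTupleSum n (λ s → indicator (s ≟ n + suc n))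
    ≡⟨ cong₂ (λ x y → x + 2 * y) (nonemptyTupleSum-deficit n 0)
                                 (nonemptyTupleSum-beyond n (n + suc n) (+-monoʳ-< n (n<1+n n))) ⟩
  1 ∎
nonemptyTupleSum-deficit (suc n) (suc d) = begin
  nonemptyTupleSum (suc n) (λ s → indicator (s + suc d ≟ suc n + suc n))
    ≡⟨ nonemptyTupleSum-suc n (λ s → indicator (s + suc d ≟ suc n + suc n)) ⟩
  nonemptyTupleSum n (λ s → indicator (suc (suc s) + suc d ≟ suc n + suc n))
    + 2 * nonemptyTupleSum n (λ s → indicator (suc s + suc d ≟ suc n + suc n))
    ≡⟨ cong₂ (λ x y → x + 2 * y)
             (nonemptyTupleSum-cong n (λ s → cong (λ m → indicator (suc s + suc d ≟ m)) (+-suc n n)))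
             (nonemptyTupleSum-cong n (λ s → cong₂ (λ x m → indicator (x ≟ m)) (+-suc s d) (+-suc n n))) ⟩
  nonemptyTupleSum n (λ s → indicator (s + suc d ≟ n + n))
    + 2 * nonemptyTupleSum n (λ s → indicator (s + d ≟ n + n))
    ≡⟨ cong₂ (λ x y → x + 2 * y) (nonemptyTupleSum-deficit n (suc d)) (nonemptyTupleSum-deficit n d) ⟩
  2 * 2 ^ d * (n C suc d) + 2 * (2 ^ d * (n C d))
    ≡⟨ regroup (2 ^ d) (n C d) (n C suc d) ⟩
  2 * 2 ^ d * (n C d + n C suc d)
    ≡⟨ cong (2 * 2 ^ d *_) (nCk+nC[k+1]≡[n+1]C[k+1] n d) ⟩
  2 ^ suc d * (suc n C suc d) ∎
  where
  regroup : ∀ p a b → 2 * p * b + 2 * (p * a) ≡ 2 * p * (a + b)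
  regroup = solve-∀

inset-byExtraPoint : ∀ n k → inset 1 n k 2 ≡
  nonemptyTupleSum n (λ s → indicator (suc s ≟ n + k)) + nonemptyTupleSum n (λ s → indicator (s ≟ n + k))
inset-byExtraPoint n k = begin
  inset 1 n k 2
    ≡⟨ length-filter≡sum-indicator (isInset? 1 n k 2) (allSubsetsX 1 n 2) ⟩
  sum (map (λ A → indicator (isInset? 1 n k 2 A)) (allSubsetsX 1 n 2))
    ≡⟨ sum-map-cartesianProduct _ (allTuples n 2) (allSubsets 1) ⟩
  sum (map (λ Ss → sum (map (λ T → indicator (isInset? 1 n k 2 (Ss , T))) (allSubsets 1))) (allTuples n 2))
    ≡⟨ sum-map-cong byExtraPoint (allTuples n 2) ⟩
  sum (map (λ Ss → with∈ Ss + without∈ Ss) (allTuples n 2))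
    ≡⟨ sum-map-+ with∈ without∈ (allTuples n 2) ⟩
  nonemptyTupleSum n (λ s → indicator (suc s ≟ n + k)) + nonemptyTupleSum n (λ s → indicator (s ≟ n + k)) ∎
  where
  with∈ without∈ : Vec (Subset 2) n → ℕ
  with∈    Ss = allNonempty Ss * indicator (suc (size Ss) ≟ n + k)
  without∈ Ss = allNonempty Ss * indicator (size Ss ≟ n + k)

  byExtraPoint : ∀ Ss → sum (map (λ T → indicator (isInset? 1 n k 2 (Ss , T))) (allSubsets 1)) ≡ with∈ Ss + without∈ Ss
  byExtraPoint Ss = cong₂ _+_
    (trans (indicator-×-dec (size Ss + 1 ≟ n + k) (all? nonempty? Ss))
           (cong (λ x → allNonempty Ss * indicator (x ≟ n + k)) (+-comm (size Ss) 1)))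
    (trans (+-identityʳ _)
      (trans (indicator-×-dec (size Ss + 0 ≟ n + k) (all? nonempty? Ss))
             (cong (λ x → allNonempty Ss * indicator (x ≟ n + k)) (+-identityʳ (size Ss)))))

inset≡8*nC3+4*nC2 : ∀ m → inset 1 (2 + m) m 2 ≡ 8 * ((2 + m) C 3) + 4 * ((2 + m) C 2)
inset≡8*nC3+4*nC2 m = begin
  inset 1 n m 2
    ≡⟨ inset-byExtraPoint n m ⟩
  nonemptyTupleSum n (λ s → indicator (suc s ≟ n + m)) + nonemptyTupleSum n (λ s → indicator (s ≟ n + m))
    ≡⟨ cong₂ _+_ (nonemptyTupleSum-cong n (λ s → cong₂ (λ x y → indicator (x ≟ y)) (+-comm 3 s) (4+2m≡n+n m)))
                 (nonemptyTupleSum-cong n (λ s → cong₂ (λ x y → indicator (x ≟ y)) (+-comm 2 s) (4+2m≡n+n m))) ⟩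
  nonemptyTupleSum n (λ s → indicator (s + 3 ≟ n + n)) + nonemptyTupleSum n (λ s → indicator (s + 2 ≟ n + n))
    ≡⟨ cong₂ _+_ (nonemptyTupleSum-deficit n 3) (nonemptyTupleSum-deficit n 2) ⟩
  8 * (n C 3) + 4 * (n C 2) ∎
  where
  n = 2 + m
  4+2m≡n+n : ∀ m → 4 + (m + m) ≡ (2 + m) + (2 + m)
  4+2m≡n+n = solve-∀

n*n≡2*nC2+n : ∀ n → n * n ≡ 2 * (n C 2) + n
n*n≡2*nC2+n zero    = refl
n*n≡2*nC2+n (suc n) = begin
  suc n * suc n                      ≡⟨ expand n ⟩
  n * n + 2 * n + 1                  ≡⟨ cong (λ x → x + 2 * n + 1) (n*n≡2*nC2+n n) ⟩
  2 * (n C 2) + n + 2 * n + 1        ≡⟨ regroup (n C 2) n ⟩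
  2 * (n + n C 2) + suc n            ≡⟨ cong (λ x → 2 * (x + n C 2) + suc n) (nC1≡n n) ⟨
  2 * (n C 1 + n C 2) + suc n        ≡⟨ cong (λ x → 2 * x + suc n) (nCk+nC[k+1]≡[n+1]C[k+1] n 1) ⟩
  2 * (suc n C 2) + suc n            ∎
  where
  expand : ∀ n → suc n * suc n ≡ n * n + 2 * n + 1
  expand = solve-∀
  regroup : ∀ c n → 2 * c + n + 2 * n + 1 ≡ 2 * (n + c) + suc n
  regroup = solve-∀

∑[i*i]≡2*nC3+nC2 : ∀ n → ∑ n (λ i → i * i) ≡ 2 * (n C 3) + n C 2
∑[i*i]≡2*nC3+nC2 zero    = refl
∑[i*i]≡2*nC3+nC2 (suc n) = begin
  ∑ (suc n) (λ i → i * i)                    ≡⟨ ∑-init-last n (λ i → i * i) ⟩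
  ∑ n (λ i → i * i) + n * n                  ≡⟨ cong₂ _+_ (∑[i*i]≡2*nC3+nC2 n) (n*n≡2*nC2+n n) ⟩
  2 * (n C 3) + n C 2 + (2 * (n C 2) + n)    ≡⟨ cong (λ x → 2 * (n C 3) + n C 2 + (2 * (n C 2) + x)) (nC1≡n n) ⟨
  2 * (n C 3) + n C 2 + (2 * (n C 2) + n C 1) ≡⟨ regroup (n C 1) (n C 2) (n C 3) ⟩
  2 * (n C 2 + n C 3) + (n C 1 + n C 2)      ≡⟨ cong₂ (λ x y → 2 * x + y) (nCk+nC[k+1]≡[n+1]C[k+1] n 2)
                                                                         (nCk+nC[k+1]≡[n+1]C[k+1] n 1) ⟩
  2 * (suc n C 3) + suc n C 2                ∎
  where
  regroup : ∀ a b c → 2 * c + b + (2 * b + a) ≡ 2 * (b + c) + (a + b)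
  regroup = solve-∀

-- Stated for n + 1 so that no truncated subtraction occurs.
2[n+1][2n+1]n≡12*∑[i*i] : ∀ n → 2 * suc n * (1 + 2 * n) * n ≡ 4 * ∑ (suc n) (λ i → i * i) * 3
2[n+1][2n+1]n≡12*∑[i*i] zero    = refl
2[n+1][2n+1]n≡12*∑[i*i] (suc n) = begin
  2 * (2 + n) * (1 + 2 * suc n) * suc n
    ≡⟨ expand n ⟩
  2 * suc n * (1 + 2 * n) * n + 12 * (suc n * suc n)
    ≡⟨ cong (_+ 12 * (suc n * suc n)) (2[n+1][2n+1]n≡12*∑[i*i] n) ⟩
  4 * S * 3 + 12 * (suc n * suc n)
    ≡⟨ regroup S (suc n * suc n) ⟩
  4 * (S + suc n * suc n) * 3
    ≡⟨ cong (λ x → 4 * x * 3) (∑-init-last (suc n) (λ i → i * i)) ⟨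
  4 * ∑ (2 + n) (λ i → i * i) * 3 ∎
  where
  S = ∑ (suc n) (λ i → i * i)
  expand : ∀ n → 2 * (2 + n) * (1 + 2 * suc n) * suc n ≡ 2 * suc n * (1 + 2 * n) * n + 12 * (suc n * suc n)
  expand = solve-∀
  regroup : ∀ s q → 4 * s * 3 + 12 * q ≡ 4 * (s + q) * 3
  regroup = solve-∀

mainTheorem16 : (n : ℕ) → 2 ≤ n →
    (inset 1 n (n ∸ 2) 2 ≡ bishopMoves n)
      × (bishopMoves n ≡ (2 * n * (2 * n ∸ 1) * (n ∸ 1)) / 3)
mainTheorem16 (suc (suc m)) (s≤s (s≤s _)) = trans insets (sym bishops) , trans bishops (sym closedForm)
  where
  n = 2 + m
  factor : ∀ a b → 8 * a + 4 * b ≡ 4 * (2 * a + b)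
  factor = solve-∀
  insets : inset 1 n m 2 ≡ 4 * ∑ n (λ i → i * i)
  insets = begin
    inset 1 n m 2                 ≡⟨ inset≡8*nC3+4*nC2 m ⟩
    8 * (n C 3) + 4 * (n C 2)     ≡⟨ factor (n C 3) (n C 2) ⟩
    4 * (2 * (n C 3) + n C 2)     ≡⟨ cong (4 *_) (∑[i*i]≡2*nC3+nC2 n) ⟨
    4 * ∑ n (λ i → i * i)         ∎
  bishops : bishopMoves n ≡ 4 * ∑ n (λ i → i * i)
  bishops = bishopMoves≡4*∑[i*i] n
  closedForm : (2 * n * (2 * n ∸ 1) * (n ∸ 1)) / 3 ≡ 4 * ∑ n (λ i → i * i)
  closedForm = begin
    (2 * n * (2 * n ∸ 1) * (n ∸ 1)) / 3      ≡⟨ cong (λ x → 2 * n * x * suc m / 3) (+-suc (suc m) (suc m + 0)) ⟩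
    (2 * n * (1 + 2 * suc m) * suc m) / 3    ≡⟨ cong (_/ 3) (2[n+1][2n+1]n≡12*∑[i*i] (suc m)) ⟩
    (4 * ∑ n (λ i → i * i) * 3) / 3          ≡⟨ m*n/n≡m (4 * ∑ n (λ i → i * i)) 3 ⟩
    4 * ∑ n (λ i → i * i)                    ∎
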